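{- Let $\beta,\beta':Y\rightharpoonup\wp(Z)$ be relations and $v\sqsubseteq\mathrm{id}_Y$. Then (a) if $\beta\sqsubseteq\beta'$ then $\beta_*\sqsubseteq\beta'_*$; (b) if $\beta$ is a pfn then $\beta_*=\hat u_{\mathrm{dom}\,\beta}\beta_\circ$; (c) if $\beta$ is a pfn then so is $\beta_*$; (d) $\beta_*=\bigsqcup_{f\sqsubseteq_c\beta}f_*$; (e) $\mathrm{dom}(\beta_*)=\hat u_{\mathrm{dom}\,\beta}$; (f) $(v\beta)_*=\hat u_v\beta_*$.
   Context: Relations $\alpha:X\rightharpoonup Y$ are subsets of $X\times Y$ (sets with the axiom of choice); juxtaposition is relational composition; $\sqsubseteq$ inclusion, $\sqcup$ union; $\mathrm{id}_Y$ identity; $\mathrm{dom}\,\alpha=\{(x,x)\mid\exists y.\,(x,y)\in\alpha\}$; a pfn is a univalent relation. For $f:Y\rightharpoonup\wp(Z)$, the Kleisli lifting $f_\circ:\wp(Y)\rightharpoonup\wp(Z)$ is $(B,A)\in f_\circ$ iff $A=\bigcup\{C\mid\exists b\in B.\,(b,C)\in f\}$. For $v\sqsubseteq\mathrm{id}_Y$, $\hat u_v=\{(A,A)\mid A\subseteq Y,\ \forall a\in A.\,(a,a)\in v\}$. $f\sqsubseteq_c\beta$ means $f\sqsubseteq\beta$, $f$ a pfn, $\mathrm{dom}\,f=\mathrm{dom}\,\beta$. Peleg lifting: $\beta_*=\bigsqcup_{f\sqsubseteq_c\beta}\hat u_{\mathrm{dom}\,\beta}f_\circ$. -}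

module Defs where

open import Level using (Level; _⊔_; 0ℓ) renaming (suc to lsuc)
open import Data.Product using (Σ; _×_)
open import Relation.Binary.PropositionalEquality using (_≡_)

private
  variable
    a b c ℓ ℓ' : Level

℘ : Set → Set₁
℘ Z = Z → Set

_≐_ : {Z : Set} → (Z → Set ℓ) → (Z → Set ℓ') → Set (ℓ ⊔ ℓ')
P ≐ Q = ∀ z → (P z → Q z) × (Q z → P z)

Rel : Set a → Set b → (ℓ : Level) → Set (a ⊔ b ⊔ lsuc ℓ)
Rel A B ℓ = A → B → Set ℓ

_⊑_ : {A : Set a} {B : Set b} → Rel A B ℓ → Rel A B ℓ' → Set (a ⊔ b ⊔ ℓ ⊔ ℓ')
R ⊑ S = ∀ x y → R x y → S x y

_≗ʳ_ : {A : Set a} {B : Set b} → Rel A B ℓ → Rel A B ℓ' → Set (a ⊔ b ⊔ ℓ ⊔ ℓ')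
R ≗ʳ S = (R ⊑ S) × (S ⊑ R)

_⨾_ : {A : Set a} {B : Set b} {C : Set c} → Rel A B ℓ → Rel B C ℓ' → Rel A C (b ⊔ ℓ ⊔ ℓ')
(R ⨾ S) x z = Σ _ (λ y → R x y × S y z)

idR : (Y : Set) → Rel Y Y 0ℓ
idR Y = _≡_

dom : {X : Set} {B : Set b} → Rel X B ℓ → Rel X X (b ⊔ ℓ)
dom {B = B} α x x' = (x ≡ x') × Σ B (α x)

-- dom α for α with domain ℘(Y); the identity on ℘(Y) is extensional equality.
dom℘ : {Y : Set} {B : Set b} → Rel (℘ Y) B ℓ → Rel (℘ Y) (℘ Y) (b ⊔ ℓ)
dom℘ {B = B} α X X' = (X ≐ X') × Σ B (α X)

Pfn : {A : Set a} {Z : Set} → Rel A (℘ Z) ℓ → Set (a ⊔ lsuc 0ℓ ⊔ ℓ)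
Pfn α = ∀ x C C' → α x C → α x C' → C ≐ C'

Kl : {Y Z : Set} → Rel Y (℘ Z) ℓ → Rel (℘ Y) (℘ Z) (lsuc 0ℓ ⊔ ℓ)
Kl {Y = Y} {Z = Z} f B A =
  A ≐ (λ z → Σ Y (λ b → B b × Σ (℘ Z) (λ C → f b C × C z)))

û : {Y : Set} → Rel Y Y ℓ → Rel (℘ Y) (℘ Y) ℓ
û v A A' = (A ≐ A') × (∀ a → A a → v a a)

_⊑c_ : {Y Z : Set} → Rel Y (℘ Z) ℓ → Rel Y (℘ Z) ℓ → Set (lsuc 0ℓ ⊔ ℓ)
f ⊑c β = (f ⊑ β) × Pfn f × (dom f ≗ʳ dom β)

_* : {Y Z : Set} → Rel Y (℘ Z) ℓ → Rel (℘ Y) (℘ Z) (lsuc 0ℓ ⊔ lsuc ℓ)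
_* {ℓ = ℓ} {Y = Y} {Z = Z} β B A =
  Σ (Rel Y (℘ Z) ℓ) (λ f → (f ⊑c β) × (û (dom β) ⨾ Kl f) B A)

⨆c* : {Y Z : Set} → Rel Y (℘ Z) ℓ → Rel (℘ Y) (℘ Z) (lsuc 0ℓ ⊔ lsuc ℓ)
⨆c* {ℓ = ℓ} {Y = Y} {Z = Z} β B A =
  Σ (Rel Y (℘ Z) ℓ) (λ f → (f ⊑c β) × (f *) B A)

-- A pfn f ⊑_c β is a choice function for β. Excluded middle (for large propositions) provides
-- a choice for every β, and a choice for β extends to one for any β' ⊒ β by following a choice
-- for β' outside dom β; this gives monotonicity (a), the domain (e), and, since v ⨾ β = v ↾ β
-- for v ⊑ id, also (f). For a pfn β every choice has the same Kleisli lifting as β itself,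
-- which gives (b) and (c); (d) holds because ⊑_c is transitive, and reflexive on pfns.
module Submission where

open import Defs
open import Level using (Level; _⊔_; 0ℓ) renaming (suc to lsuc)
open import Data.Bool.Properties using (T-irrelevant)
open import Data.Product using (Σ; Σ-syntax; ∃; _×_; _,_; proj₁; proj₂)
open import Data.Empty using (⊥-elim)
open import Data.Sum using (_⊎_; inj₁; inj₂)
open import Function using (id; _∘_)
open import Relation.Nullary using (¬_; Dec; yes; no)
open import Relation.Nullary.Decidable using (True; toWitness; fromWitness)
open import Relation.Binary.PropositionalEquality using (_≡_; refl)
open import Relation.Unary using (_⊆_)
open import Axiom.ExcludedMiddle using (ExcludedMiddle)

private
  variable
    a b c ℓ ℓ' ℓ'' : Level

module _ {Z : Set} {P : Z → Set ℓ} where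

  ≐-refl : P ≐ P
  ≐-refl z = id , id

  ≐-sym : {Q : Z → Set ℓ'} → P ≐ Q → Q ≐ P
  ≐-sym P≐Q z = proj₂ (P≐Q z) , proj₁ (P≐Q z)

  ≐-trans : {Q : Z → Set ℓ'} {R : Z → Set ℓ''} → P ≐ Q → Q ≐ R → P ≐ R
  ≐-trans P≐Q Q≐R z = (λ p → proj₁ (Q≐R z) (proj₁ (P≐Q z) p))
                    , (λ r → proj₂ (P≐Q z) (proj₂ (Q≐R z) r))

module _ {A : Set a} {B : Set b} {C : Set c} where

  ⨾-monoˡ : {R : Rel A B ℓ} {R' : Rel A B ℓ'} {S : Rel B C ℓ''} → R ⊑ R' → (R ⨾ S) ⊑ (R' ⨾ S)
  ⨾-monoˡ R⊑R' x z (y , r , s) = y , R⊑R' x y r , s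

dom-mono : {X : Set} {B : Set b} {β : Rel X B ℓ} {β' : Rel X B ℓ'} → β ⊑ β' → dom β ⊑ dom β'
dom-mono β⊑β' x x' (x≡x' , C , βxC) = x≡x' , C , β⊑β' x C βxC

û-mono : {Y : Set} {v : Rel Y Y ℓ} {v' : Rel Y Y ℓ'} → v ⊑ v' → û v ⊑ û v'
û-mono v⊑v' A A' (A≐A' , vA) = A≐A' , λ a Aa → v⊑v' a a (vA a Aa)

û-codomain : {Y : Set} {v : Rel Y Y ℓ} {A A' : ℘ Y} → û v A A' → ∀ a → A' a → v a a
û-codomain (A≐A' , vA) a A'a = vA a (proj₂ (A≐A' a) A'a)

module _ {Y Z : Set} where

  _≲[_]_ : Rel Y (℘ Z) ℓ → ℘ Y → Rel Y (℘ Z) ℓ' → Set (lsuc 0ℓ ⊔ ℓ ⊔ ℓ')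
  f ≲[ B ] g = ∀ b → B b → ∀ C → f b C → ∃ λ C' → g b C' × C ⊆ C'

  ⊑⇒≲ : {f : Rel Y (℘ Z) ℓ} {g : Rel Y (℘ Z) ℓ'} {B : ℘ Y} →
    (∀ b → B b → ∀ C → f b C → g b C) → f ≲[ B ] g
  ⊑⇒≲ f⊑g b Bb C fbC = C , f⊑g b Bb C fbC , id

  Kl-cong : {f : Rel Y (℘ Z) ℓ} {g : Rel Y (℘ Z) ℓ'} {B : ℘ Y} {A : ℘ Z} →
    f ≲[ B ] g → g ≲[ B ] f → Kl f B A → Kl g B A
  Kl-cong {f = f} {g} {B} {A} f≲g g≲f fBA z = to , from
    where
    to : A z → Σ Y λ b → B b × Σ (℘ Z) λ C → g b C × C z
    to Az with proj₁ (fBA z) Az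
    ... | b , Bb , C , fbC , Cz with f≲g b Bb C fbC
    ...   | C' , gbC' , C⊆C' = b , Bb , C' , gbC' , C⊆C' Cz
    from : (Σ Y λ b → B b × Σ (℘ Z) λ C → g b C × C z) → A z
    from (b , Bb , C , gbC , Cz) with g≲f b Bb C gbC
    ... | C' , fbC' , C⊆C' = proj₂ (fBA z) (b , Bb , C' , fbC' , C⊆C' Cz)

  Kl-resp-≐ : {f : Rel Y (℘ Z) ℓ} {B B' : ℘ Y} {A : ℘ Z} → B ≐ B' → Kl f B A → Kl f B' A
  Kl-resp-≐ B≐B' fBA z =
      (λ Az → let (b , Bb , rest) = proj₁ (fBA z) Az in b , proj₁ (B≐B' b) Bb , rest)
    , (λ { (b , B'b , rest) → proj₂ (fBA z) (b , proj₂ (B≐B' b) B'b , rest) })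

  Kl-functional : {f : Rel Y (℘ Z) ℓ} {B : ℘ Y} {A A' : ℘ Z} → Kl f B A → Kl f B A' → A ≐ A'
  Kl-functional fBA fBA' = ≐-trans fBA (≐-sym fBA')

  ⊑c-refl : {f : Rel Y (℘ Z) ℓ} → Pfn f → f ⊑c f
  ⊑c-refl f-pfn = (λ _ _ → id) , f-pfn , (λ _ _ → id) , (λ _ _ → id)

  ⊑c-trans : {h f β : Rel Y (℘ Z) ℓ} → h ⊑c f → f ⊑c β → h ⊑c β
  ⊑c-trans (h⊑f , h-pfn , dom-h⊑ , dom-h⊒) (f⊑β , _ , dom-f⊑ , dom-f⊒) =
      (λ y C → f⊑β y C ∘ h⊑f y C)
    , h-pfn
    , (λ y y' → dom-f⊑ y y' ∘ dom-h⊑ y y')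
    , (λ y y' → dom-h⊒ y y' ∘ dom-f⊒ y y')

  -- A choice for a pfn β picks, up to ≐, the unique image of β at every point of dom β.
  Kl-⊑c-pfn : {f β : Rel Y (℘ Z) ℓ} {B : ℘ Y} {A : ℘ Z} →
    f ⊑c β → Pfn β → Kl f B A → Kl β B A
  Kl-⊑c-pfn {f = f} {β} {B} (f⊑β , _ , _ , dom-f⊒) β-pfn = Kl-cong (⊑⇒≲ (λ b _ → f⊑β b)) β≲f
    where
    β≲f : β ≲[ B ] f
    β≲f b _ C βbC with proj₂ (dom-f⊒ b b (refl , C , βbC))
    ... | C' , fbC' = C' , fbC' , λ {z} → proj₁ (β-pfn b C C' βbC (f⊑β b C' fbC') z)

  ⊑c⇒*-⊑ : {f β : Rel Y (℘ Z) ℓ} → f ⊑c β → (f *) ⊑ (β *)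
  ⊑c⇒*-⊑ f⊑cβ@(_ , _ , dom-f⊑ , _) B A (h , h⊑cf , lifted) =
    h , ⊑c-trans h⊑cf f⊑cβ , ⨾-monoˡ {S = Kl h} (û-mono dom-f⊑) B A lifted

  pfn⇒Kl-⊑-* : {f : Rel Y (℘ Z) ℓ} → Pfn f → (û (dom f) ⨾ Kl f) ⊑ (f *)
  pfn⇒Kl-⊑-* f-pfn B A lifted = _ , ⊑c-refl f-pfn , lifted

  *-⊑-⨆c* : (β : Rel Y (℘ Z) ℓ) → (β *) ⊑ ⨆c* β
  *-⊑-⨆c* β B A (f , f⊑cβ@(_ , f-pfn , _ , dom-f⊒) , lifted) =
    f , f⊑cβ , pfn⇒Kl-⊑-* f-pfn B A (⨾-monoˡ {S = Kl f} (û-mono dom-f⊒) B A lifted)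

  ⨆c*-⊑-* : (β : Rel Y (℘ Z) ℓ) → ⨆c* β ⊑ (β *)
  ⨆c*-⊑-* β B A (f , f⊑cβ , f*BA) = ⊑c⇒*-⊑ f⊑cβ B A f*BA

  pfn⇒*-⊑-Kl : {β : Rel Y (℘ Z) ℓ} → Pfn β → (β *) ⊑ (û (dom β) ⨾ Kl β)
  pfn⇒*-⊑-Kl β-pfn B A (f , f⊑cβ , B' , u , fB'A) = B' , u , Kl-⊑c-pfn f⊑cβ β-pfn fB'A

  pfn⇒*-pfn : {β : Rel Y (℘ Z) ℓ} → Pfn β → Pfn (β *)
  pfn⇒*-pfn β-pfn B A A' β*BA β*BA'
    with pfn⇒*-⊑-Kl β-pfn B A β*BA | pfn⇒*-⊑-Kl β-pfn B A' β*BA'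
  ... | B₁ , (B≐B₁ , _) , βB₁A | B₂ , (B≐B₂ , _) , βB₂A' =
    Kl-functional βB₁A (Kl-resp-≐ (≐-trans (≐-sym B≐B₂) B≐B₁) βB₂A')

  dom℘-*-⊑ : (β : Rel Y (℘ Z) ℓ) → dom℘ (β *) ⊑ û (dom β)
  dom℘-*-⊑ β B B' (B≐B' , _ , _ , _ , _ , (_ , domβ) , _) = B≐B' , domβ

  _↾_ : Rel Y Y ℓ → Rel Y (℘ Z) ℓ' → Rel Y (℘ Z) (ℓ ⊔ ℓ')
  (v ↾ β) y C = v y y × β y C

  ↾-⊑ : (v : Rel Y Y ℓ) (β : Rel Y (℘ Z) ℓ') → (v ↾ β) ⊑ β
  ↾-⊑ v β y C = proj₂

  ⨾-coreflexive : {v : Rel Y Y ℓ} (β : Rel Y (℘ Z) ℓ') → v ⊑ idR Y → (v ⨾ β) ≗ʳ (v ↾ β)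
  ⨾-coreflexive {v = v} β v⊑id = to , from
    where
    to : (v ⨾ β) ⊑ (v ↾ β)
    to y C (y' , vyy' , βy'C) with v⊑id y y' vyy'
    ... | refl = vyy' , βy'C
    from : (v ↾ β) ⊑ (v ⨾ β)
    from y C (vyy , βyC) = y , vyy , βyC

  ↾-⊑c : {v : Rel Y Y ℓ} {f β : Rel Y (℘ Z) ℓ'} → f ⊑c β → (v ↾ f) ⊑c (v ↾ β)
  ↾-⊑c (f⊑β , f-pfn , dom-f⊑ , dom-f⊒) =
      (λ y C (vyy , fyC) → vyy , f⊑β y C fyC)
    , (λ y C C' (_ , fyC) (_ , fyC') → f-pfn y C C' fyC fyC')
    , (λ { y y' (y≡y' , C , vyy , fyC) → y≡y' , C , vyy , f⊑β y C fyC })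
    , (λ { y y' (y≡y' , C , vyy , βyC) →
           let (_ , C' , fyC') = dom-f⊒ y y (refl , C , βyC) in y≡y' , C' , vyy , fyC' })

  ↾-*-⊒ : {v : Rel Y Y ℓ} (β : Rel Y (℘ Z) ℓ') → (û v ⨾ (β *)) ⊑ ((v ↾ β) *)
  ↾-*-⊒ {v = v} β B A (B₁ , (B≐B₁ , vB) , f , f⊑cβ , B₂ , (B₁≐B₂ , domβ) , fB₂A) =
    v ↾ f , ↾-⊑c {v = v} f⊑cβ , B₂ , (B≐B₂ , dom-v↾β) ,
    Kl-cong (⊑⇒≲ λ b B₂b C fbC → vB b (proj₂ (B≐B₂ b) B₂b) , fbC) (⊑⇒≲ λ b _ C → proj₂) fB₂A
    where
    B≐B₂ : B ≐ B₂
    B≐B₂ = ≐-trans B≐B₁ B₁≐B₂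
    dom-v↾β : ∀ a → B a → dom (v ↾ β) a a
    dom-v↾β a Ba with domβ a (proj₁ (B≐B₁ a) Ba)
    ... | _ , C , βaC = refl , C , vB a Ba , βaC

module WithExcludedMiddle (em : ExcludedMiddle (lsuc 0ℓ)) {Y Z : Set} where

  -- Inhabitedness of β y is a large proposition; excluded middle makes it small.
  record Defined (β : Rel Y (℘ Z) 0ℓ) (y : Y) : Set where
    field
      decided : True (em {Σ (℘ Z) (β y)})

  module _ {β : Rel Y (℘ Z) 0ℓ} {y : Y} where

    witness : Defined β y → Σ (℘ Z) (β y)
    witness d = toWitness (Defined.decided d)

    defined : Σ (℘ Z) (β y) → Defined β y
    defined w = record { decided = fromWitness w }

    Defined-irrelevant : (d d' : Defined β y) → d ≡ d'
    Defined-irrelevant d d' with T-irrelevant (Defined.decided d) (Defined.decided d')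
    ... | refl = refl

  choice : Rel Y (℘ Z) 0ℓ → Rel Y (℘ Z) 0ℓ
  choice β y C = Σ[ d ∈ Defined β y ] (C ≐ proj₁ (witness d) × β y C)

  choice-⊑c : (β : Rel Y (℘ Z) 0ℓ) → choice β ⊑c β
  choice-⊑c β = (λ y C → proj₂ ∘ proj₂) , choice-pfn , dom-⊑ , dom-⊒
    where
    choice-pfn : Pfn (choice β)
    choice-pfn y C C' (d , C≐ , _) (d' , C'≐ , _) with Defined-irrelevant d d'
    ... | refl = ≐-trans C≐ (≐-sym C'≐)
    dom-⊑ : dom (choice β) ⊑ dom β
    dom-⊑ y y' (y≡y' , C , _ , _ , βyC) = y≡y' , C , βyC
    dom-⊒ : dom β ⊑ dom (choice β)
    dom-⊒ y y' (y≡y' , C , βyC) =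
      y≡y' , proj₁ (witness d) , d , ≐-refl {P = proj₁ (witness d)} , proj₂ (witness d)
      where
      d : Defined β y
      d = defined (C , βyC)

  -- ℘ Z consists of small predicates while the union defining Kl f B is large; excluded
  -- middle resizes it.
  Kl-total : (f : Rel Y (℘ Z) 0ℓ) (B : ℘ Y) → ∃ (Kl f B)
  Kl-total f B = (λ z → True (em {⋃ z})) , λ z → toWitness {a? = em} , fromWitness {a? = em}
    where
    ⋃ : Z → Set₁
    ⋃ z = Σ Y λ b → B b × Σ (℘ Z) λ C → f b C × C z

  _◁_ : Rel Y (℘ Z) 0ℓ → Rel Y (℘ Z) 0ℓ → Rel Y (℘ Z) 0ℓ
  (f ◁ g) y C = f y C ⊎ (¬ Defined f y × g y C)

  module _ {f g : Rel Y (℘ Z) 0ℓ} where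

    ◁-⊑ : {h : Rel Y (℘ Z) 0ℓ} → f ⊑ h → g ⊑ h → (f ◁ g) ⊑ h
    ◁-⊑ f⊑h g⊑h y C (inj₁ fyC)       = f⊑h y C fyC
    ◁-⊑ f⊑h g⊑h y C (inj₂ (_ , gyC)) = g⊑h y C gyC

    ◁-pfn : Pfn f → Pfn g → Pfn (f ◁ g)
    ◁-pfn f-pfn g-pfn y C C' (inj₁ fyC)       (inj₁ fyC')        = f-pfn y C C' fyC fyC'
    ◁-pfn f-pfn g-pfn y C C' (inj₂ (_ , gyC)) (inj₂ (_ , gyC'))  = g-pfn y C C' gyC gyC'
    ◁-pfn f-pfn g-pfn y C C' (inj₁ fyC)       (inj₂ (¬def , _))  = ⊥-elim (¬def (defined (C , fyC)))
    ◁-pfn f-pfn g-pfn y C C' (inj₂ (¬def , _)) (inj₁ fyC')       = ⊥-elim (¬def (defined (C' , fyC')))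

    dom-◁ʳ : dom g ⊑ dom (f ◁ g)
    dom-◁ʳ y y' (y≡y' , C , gyC) = y≡y' , image em
      where
      image : Dec (Σ (℘ Z) (f y)) → Σ (℘ Z) ((f ◁ g) y)
      image (yes (C' , fyC')) = C' , inj₁ fyC'
      image (no ¬fy)          = C , inj₂ ((λ d → ¬fy (witness d)) , gyC)

    ◁-≲ˡ : {B : ℘ Y} → f ≲[ B ] (f ◁ g)
    ◁-≲ˡ = ⊑⇒≲ λ _ _ _ → inj₁

    ◁-≲ʳ : {B : ℘ Y} → (∀ b → B b → Σ (℘ Z) (f b)) → (f ◁ g) ≲[ B ] f
    ◁-≲ʳ B⊆dom-f = ⊑⇒≲ λ where
      b Bb C (inj₁ fbC)        → fbC
      b Bb C (inj₂ (¬def , _)) → ⊥-elim (¬def (defined (B⊆dom-f b Bb)))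

  extend-⊑c : {f β β' : Rel Y (℘ Z) 0ℓ} → f ⊑c β → β ⊑ β' → (f ◁ choice β') ⊑c β'
  extend-⊑c {f} {β' = β'} (f⊑β , f-pfn , _) β⊑β' with choice-⊑c β'
  ... | choice⊑β' , choice-pfn , _ , dom-choice-⊒ =
      g⊑β'
    , ◁-pfn f-pfn choice-pfn
    , dom-mono g⊑β'
    , (λ y y' → dom-◁ʳ {f} {choice β'} y y' ∘ dom-choice-⊒ y y')
    where
    g⊑β' : (f ◁ choice β') ⊑ β'
    g⊑β' = ◁-⊑ (λ y C → β⊑β' y C ∘ f⊑β y C) choice⊑β'

  *-mono : {β β' : Rel Y (℘ Z) 0ℓ} → β ⊑ β' → (β *) ⊑ (β' *)
  *-mono {β} {β'} β⊑β' B A (f , f⊑cβ@(_ , _ , _ , dom-f⊒) , B' , u , fB'A) =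
      f ◁ choice β'
    , extend-⊑c f⊑cβ β⊑β'
    , B'
    , û-mono {v = dom β} {v' = dom β'} (dom-mono β⊑β') B B' u
    , Kl-cong {f = f} {g = f ◁ choice β'} ◁-≲ˡ
        (◁-≲ʳ λ b B'b → proj₂ (dom-f⊒ b b (û-codomain {v = dom β} u b B'b))) fB'A

  *-resp-≗ʳ : {β β' : Rel Y (℘ Z) 0ℓ} → β ≗ʳ β' → (β *) ≗ʳ (β' *)
  *-resp-≗ʳ (β⊑β' , β'⊑β) = *-mono β⊑β' , *-mono β'⊑β

  dom℘-*-⊒ : (β : Rel Y (℘ Z) 0ℓ) → û (dom β) ⊑ dom℘ (β *)
  dom℘-*-⊒ β B B' u@(B≐B' , _) =
    B≐B' , proj₁ lifted , choice β , choice-⊑c β , B' , u , proj₂ lifted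
    where
    lifted : ∃ (Kl (choice β) B')
    lifted = Kl-total (choice β) B'

  ↾-*-⊑ : (v : Rel Y Y 0ℓ) (β : Rel Y (℘ Z) 0ℓ) → ((v ↾ β) *) ⊑ (û v ⨾ (β *))
  ↾-*-⊑ v β B A v↾β*BA@(_ , _ , _ , u , _) =
    B , (≐-refl , v-on-B) , *-mono {β = v ↾ β} (↾-⊑ v β) B A v↾β*BA
    where
    v-on-B : ∀ a → B a → v a a
    v-on-B a Ba with proj₂ u a Ba
    ... | _ , _ , vaa , _ = vaa

  ⨾-coreflexive-* : {v : Rel Y Y 0ℓ} (β : Rel Y (℘ Z) 0ℓ) → v ⊑ idR Y →
    ((v ⨾ β) *) ≗ʳ (û v ⨾ (β *))
  ⨾-coreflexive-* {v = v} β v⊑id =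
      (λ B A → ↾-*-⊑ v β B A ∘ proj₁ v⨾β*≗v↾β* B A)
    , (λ B A → proj₂ v⨾β*≗v↾β* B A ∘ ↾-*-⊒ {v = v} β B A)
    where
    v⨾β*≗v↾β* : ((v ⨾ β) *) ≗ʳ ((v ↾ β) *)
    v⨾β*≗v↾β* = *-resp-≗ʳ (⨾-coreflexive β v⊑id)

proposition6p3 : ExcludedMiddle (lsuc 0ℓ) →
    {Y Z : Set} (β β' : Rel Y (℘ Z) 0ℓ) (v : Rel Y Y 0ℓ) → v ⊑ idR Y →
      ((β ⊑ β') → (β *) ⊑ (β' *))
      × (Pfn β → (β *) ≗ʳ (û (dom β) ⨾ Kl β))
      × (Pfn β → Pfn (β *))
      × ((β *) ≗ʳ ⨆c* β)
      × (dom℘ (β *) ≗ʳ û (dom β))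
      × (((v ⨾ β) *) ≗ʳ (û v ⨾ (β *)))
proposition6p3 em β β' v v⊑id =
    *-mono
  , (λ β-pfn → pfn⇒*-⊑-Kl β-pfn , pfn⇒Kl-⊑-* β-pfn)
  , pfn⇒*-pfn
  , (*-⊑-⨆c* β , ⨆c*-⊑-* β)
  , (dom℘-*-⊑ β , dom℘-*-⊒ β)
  , ⨾-coreflexive-* β v⊑id
  where
  open WithExcludedMiddle em
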